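{- Let $\mathcal{CS}$ be a pure $\mathsf{C}$-axiomatically appropriate constant specification. For any formula $A$ and any $s\in\mathrm{Tm}_{\mathsf{E}}$, if $\vdash_{\mathcal{CS}} A\to s{:}_{\mathsf{E}}A$, then there is a term $t\in\mathrm{Tm}_{\mathsf{C}}$ such that $\vdash_{\mathcal{CS}} A\to \mathsf{ind}(t,s){:}_{\mathsf{C}}A$.
   Context: Fix a number $h\ge 1$ of agents. Throughout, $i$ ranges over $\{1,\dots,h\}$, $*$ over $\{1,\dots,h,\mathsf{C}\}$, and $\circledast$ over $\{1,\dots,h,\mathsf{E},\mathsf{C}\}$. For each $\circledast$ let $\mathrm{Cons}_\circledast$ (proof constants) and $\mathrm{Var}_\circledast$ (proof variables) be countably infinite sets, all pairwise disjoint. Evidence terms $\mathrm{Tm}_1,\dots,\mathrm{Tm}_h,\mathrm{Tm}_{\mathsf{E}},\mathrm{Tm}_{\mathsf{C}}$ are defined by simultaneous induction: $\mathrm{Cons}_\circledast\cup\mathrm{Var}_\circledast\subseteq\mathrm{Tm}_\circledast$; if $t\in\mathrm{Tm}_i$ then $!_i t\in\mathrm{Tm}_i$; if $t,s\in\mathrm{Tm}_*$ then $t+_*s,\ t\cdot_* s\in\mathrm{Tm}_*$; if $t_1\in\mathrm{Tm}_1,\dots,t_h\in\mathrm{Tm}_h$ then $\langle t_1,\dots,t_h\rangle\in\mathrm{Tm}_{\mathsf{E}}$; if $t\in\mathrm{Tm}_{\mathsf{E}}$ then $\pi_i t\in\mathrm{Tm}_i$; if $t\in\mathrm{Tm}_{\mathsf{C}}$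 then $\mathsf{hd}(t),\mathsf{tl}(t)\in\mathrm{Tm}_{\mathsf{E}}$; if $t\in\mathrm{Tm}_{\mathsf{C}}$ and $s\in\mathrm{Tm}_{\mathsf{E}}$ then $\mathsf{ind}(t,s)\in\mathrm{Tm}_{\mathsf{C}}$. Formulae are built from a countable set $\mathrm{Prop}$ of propositional variables using $\neg,\wedge,\vee,\to$ and the rule: if $A$ is a formula and $t\in\mathrm{Tm}_\circledast$ then $t{:}_\circledast A$ is a formula (indices on $!,+,\cdot$ omitted when clear). Axioms of $\mathsf{LP}^{\mathsf{C}}_h$ (all instances): (1) propositional tautologies; (2) $t{:}_*(A\to B)\to(s{:}_*A\to (t\cdot s){:}_*B)$; (3) $t{:}_*A\to(t+s){:}_*A$ and $s{:}_*A\to(t+s){:}_*A$; (4) $t{:}_iA\to A$; (5) $t{:}_iA\to (!t){:}_i\, t{:}_iA$; (6) $t_1{:}_1A\wedge\dots\wedge t_h{:}_hA\to\langle t_1,\dots,t_h\rangle{:}_{\mathsf{E}}A$; (7) $t{:}_{\mathsf{E}}A\to (\pi_it){:}_iA$; (8) $t{:}_{\mathsf{C}}A\to\mathsf{hd}(t){:}_{\mathsf{E}}A$ and $t{:}_{\mathsf{C}}A\to\mathsf{tl}(t){:}_{\mathsf{E}}\,t{:}_{\mathsf{C}}A$; (9) $A\wedge t{:}_{\mathsf{C}}(A\to s{:}_{\mathsf{E}}A)\to\mathsf{ind}(t,s){:}_{\mathsf{C}}A$. A constant specification $\mathcal{CS}$ is any set of formulae $c{:}_\circledast A$ with $c\in\mathrm{Cons}_\circledast$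 and $A$ an axiom. It is $\mathsf{C}$-axiomatically appropriate if for each axiom $A$ there is $c\in\mathrm{Cons}_{\mathsf{C}}$ with $c{:}_{\mathsf{C}}A\in\mathcal{CS}$; it is pure if there is a fixed $\circledast$ with $\mathcal{CS}\subseteq\{c{:}_\circledast A: c\in\mathrm{Cons}_\circledast, A \text{ an axiom}\}$. $\mathsf{LP}^{\mathsf{C}}_h(\mathcal{CS})$ is the Hilbert system with these axioms, modus ponens, and axiom necessitation (derive $c{:}_\circledast A$ whenever $c{:}_\circledast A\in\mathcal{CS}$); $\vdash_{\mathcal{CS}}A$ means $A$ is derivable in it. -}

module Defs where

open import Data.Nat using (ℕ; zero; suc; _≤_)
open import Data.Fin using (Fin)
import Data.Fin as Fin
open import Data.Bool using (Bool; true; false; not; _∧_; _∨_)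
open import Data.Product using (Σ; _×_; ∃; _,_)
open import Relation.Binary.PropositionalEquality using (_≡_)

module _ (h : ℕ) where

  -- Sorts ⊛ : agents 1..h (as Fin h), E, C.
  data Sort : Set where
    ag : Fin h → Sort
    E  : Sort
    C  : Sort

  data Star : Set where
    ag* : Fin h → Star
    C*  : Star

  ⟦_⟧* : Star → Sort
  ⟦ ag* i ⟧* = ag i
  ⟦ C* ⟧*    = C

  -- Evidence terms indexed by sort. Constants and variables of sort σ are
  -- cons σ n / var σ n, n : ℕ (countably infinite, pairwise disjoint).
  data Tm : Sort → Set where
    cons : (σ : Sort) → ℕ → Tm σ
    var  : (σ : Sort) → ℕ → Tm σ
    bang : (i : Fin h) → Tm (ag i) → Tm (ag i)
    plus : (s : Star) → Tm ⟦ s ⟧* → Tm ⟦ s ⟧* → Tm ⟦ s ⟧*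
    app  : (s : Star) → Tm ⟦ s ⟧* → Tm ⟦ s ⟧* → Tm ⟦ s ⟧*
    tup  : ((i : Fin h) → Tm (ag i)) → Tm E
    proj : (i : Fin h) → Tm E → Tm (ag i)
    hd   : Tm C → Tm E
    tl   : Tm C → Tm E
    ind  : Tm C → Tm E → Tm C

  -- Formulae; jst σ t A is t :_σ A.
  data Fm : Set where
    prop : ℕ → Fm
    neg  : Fm → Fm
    conj : Fm → Fm → Fm
    disj : Fm → Fm → Fm
    imp  : Fm → Fm → Fm
    jst  : (σ : Sort) → Tm σ → Fm → Fm

  -- Propositional evaluation: propositional variables and justification
  -- formulas are treated as atoms, valued by v.
  eval : (Fm → Bool) → Fm → Bool
  eval v (prop p)    = v (prop p)
  eval v (neg A)     = not (eval v A)
  eval v (conj A B)  = eval v A ∧ eval v B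
  eval v (disj A B)  = eval v A ∨ eval v B
  eval v (imp A B)   = not (eval v A) ∨ eval v B
  eval v (jst σ t A) = v (jst σ t A)

  Tautology : Fm → Set
  Tautology A = (v : Fm → Bool) → eval v A ≡ true

  -- Finite conjunction A_0 ∧ (A_1 ∧ (… ∧ A_{n-1})). For n = 0 (not used,
  -- since h ≥ 1 in the theorem) it is the tautology p₀ → p₀.
  bigConj : ∀ {n} → (Fin n → Fm) → Fm
  bigConj {zero} f = imp (prop 0) (prop 0)
  bigConj {suc zero} f = f Fin.zero
  bigConj {suc (suc n)} f = conj (f Fin.zero) (bigConj (λ i → f (Fin.suc i)))

  data Axiom : Fm → Set where
    ax-taut : ∀ {A} → Tautology A → Axiom A
    ax-app  : ∀ (s : Star) (t u : Tm ⟦ s ⟧*) A B →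
              Axiom (imp (jst ⟦ s ⟧* t (imp A B))
                         (imp (jst ⟦ s ⟧* u A) (jst ⟦ s ⟧* (app s t u) B)))
    ax-sumˡ : ∀ (s : Star) (t u : Tm ⟦ s ⟧*) A →
              Axiom (imp (jst ⟦ s ⟧* t A) (jst ⟦ s ⟧* (plus s t u) A))
    ax-sumʳ : ∀ (s : Star) (t u : Tm ⟦ s ⟧*) A →
              Axiom (imp (jst ⟦ s ⟧* u A) (jst ⟦ s ⟧* (plus s t u) A))
    ax-refl : ∀ (i : Fin h) (t : Tm (ag i)) A →
              Axiom (imp (jst (ag i) t A) A)
    ax-bang : ∀ (i : Fin h) (t : Tm (ag i)) A →
              Axiom (imp (jst (ag i) t A) (jst (ag i) (bang i t) (jst (ag i) t A)))
    ax-tup  : ∀ (ts : (i : Fin h) → Tm (ag i)) A →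
              Axiom (imp (bigConj (λ i → jst (ag i) (ts i) A)) (jst E (tup ts) A))
    ax-proj : ∀ (i : Fin h) (t : Tm E) A →
              Axiom (imp (jst E t A) (jst (ag i) (proj i t) A))
    ax-hd   : ∀ (t : Tm C) A →
              Axiom (imp (jst C t A) (jst E (hd t) A))
    ax-tl   : ∀ (t : Tm C) A →
              Axiom (imp (jst C t A) (jst E (tl t) (jst C t A)))
    ax-ind  : ∀ (t : Tm C) (s : Tm E) A →
              Axiom (imp (conj A (jst C t (imp A (jst E s A)))) (jst C (ind t s) A))

  -- Constant specifications: a set of triples (σ, c, A), meaning c :_σ A
  -- with c ∈ Cons_σ (c = cons σ n is represented by n) and A an axiom.
  record ConstSpec : Set₁ where
    field
      mem      : Sort → ℕ → Fm → Set
      axiomatic : ∀ {σ n A} → mem σ n A → Axiom A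
  open ConstSpec public

  CAxAppropriate : ConstSpec → Set
  CAxAppropriate CS = ∀ A → Axiom A → ∃ λ n → mem CS C n A

  Pure : ConstSpec → Set
  Pure CS = ∃ λ (σ₀ : Sort) → ∀ σ n A → mem CS σ n A → σ ≡ σ₀

  data _⊢_ (CS : ConstSpec) : Fm → Set where
    axiom : ∀ {A} → Axiom A → CS ⊢ A
    mp    : ∀ {A B} → CS ⊢ imp A B → CS ⊢ A → CS ⊢ B
    an    : ∀ {σ n A} → mem CS σ n A → CS ⊢ jst σ (cons σ n) A

-- Internalisation: every theorem B of LP^C_h(CS) has a C-justification t with ⊢ t :_C B,
-- built along the derivation (constants from C-appropriateness for axioms, application for
-- modus ponens). Applying it to ⊢ A → s :_E A gives t :_C (A → s :_E A), and the induction
-- axiom then yields ⊢ A → ind(t, s) :_C A. Purity matters only for necessitated constants: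
-- it forces them to be C-constants c, and c :_C B itself is C-justified by ind(e, tl c),
-- the induction axiom applied to the instance c :_C B → tl c :_E c :_C B of axiom (8).
module Submission where

open import Defs
open import Data.Nat using (ℕ; _≤_)
open import Data.Product using (∃; _,_)
open import Data.Bool using (true; false; not; _∧_; _∨_)
open import Relation.Binary.PropositionalEquality using (_≡_; refl; sym; trans)

∧-intro-valid : ∀ a b → not a ∨ (not b ∨ a ∧ b) ≡ true
∧-intro-valid true  true  = refl
∧-intro-valid true  false = refl
∧-intro-valid false _     = refl

∧-export-valid : ∀ a b c → not (not (a ∧ b) ∨ c) ∨ (not b ∨ (not a ∨ c)) ≡ true
∧-export-valid true  true  true  = refl
∧-export-valid true  true  false = refl
∧-export-valid true  false _     = refl
∧-export-valid false true  _     = refl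
∧-export-valid false false _     = refl

∨-excluded-middle : ∀ a → not a ∨ a ≡ true
∨-excluded-middle true  = refl
∨-excluded-middle false = refl

module _ {h : ℕ} {CS : ConstSpec h} where

  ⊢-∧-intro : ∀ {A B} → _⊢_ h CS A → _⊢_ h CS B → _⊢_ h CS (conj A B)
  ⊢-∧-intro {A} {B} ⊢A ⊢B =
    mp (mp (axiom (ax-taut (λ v → ∧-intro-valid (eval h v A) (eval h v B)))) ⊢A) ⊢B

  ⊢-discharge-∧ʳ : ∀ {A B D} → _⊢_ h CS (imp (conj A B) D) → _⊢_ h CS B → _⊢_ h CS (imp A D)
  ⊢-discharge-∧ʳ {A} {B} {D} ⊢A∧B→D ⊢B =
    mp (mp (axiom (ax-taut λ v → ∧-export-valid (eval h v A) (eval h v B) (eval h v D)))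
           ⊢A∧B→D)
       ⊢B

pure∧C-appropriate⇒sort≡C : ∀ {h} (CS : ConstSpec h) → Pure h CS → CAxAppropriate h CS →
                             ∀ {σ n A} → mem CS σ n A → σ ≡ C
pure∧C-appropriate⇒sort≡C CS (σ₀ , all-σ₀) cax {σ} m
  with cax (imp (prop 0) (prop 0)) (ax-taut λ v → ∨-excluded-middle (v (prop 0)))
... | k , mk = trans (all-σ₀ σ _ _ m) (sym (all-σ₀ C k _ mk))

module _ {h : ℕ} (CS : ConstSpec h) (pure : Pure h CS) (cax : CAxAppropriate h CS) where

  necessitation-C : ∀ {n B} → mem CS C n B →
                    ∃ λ (t : Tm h C) → _⊢_ h CS (jst C t (jst C (cons C n) B))
  necessitation-C {n} {B} m with cax _ (ax-tl (cons C n) B)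
  ... | e , me = ind (cons C e) (tl (cons C n)) ,
                 mp (axiom (ax-ind (cons C e) (tl (cons C n)) (jst C (cons C n) B)))
                    (⊢-∧-intro (an m) (an me))

  internalise-C : ∀ {B} → _⊢_ h CS B → ∃ λ (t : Tm h C) → _⊢_ h CS (jst C t B)
  internalise-C (axiom {B} ax) with cax B ax
  ... | n , m = cons C n , an m
  internalise-C (mp ⊢B→D ⊢B) with internalise-C ⊢B→D | internalise-C ⊢B
  ... | t , ⊢t | u , ⊢u = app C* t u , mp (mp (axiom (ax-app C* t u _ _)) ⊢t) ⊢u
  internalise-C (an m) with pure∧C-appropriate⇒sort≡C CS pure cax m
  ... | refl = necessitation-C m

lemma6 : (h : ℕ) → 1 ≤ h → (CS : ConstSpec h) → Pure h CS → CAxAppropriate h CS →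
    (A : Fm h) (s : Tm h (E {h})) →
    _⊢_ h CS (imp A (jst (E {h}) s A)) →
    ∃ λ (t : Tm h (C {h})) → _⊢_ h CS (imp A (jst (C {h}) (ind t s) A))
lemma6 h _ CS pure cax A s ⊢A→sA with internalise-C CS pure cax ⊢A→sA
... | t , ⊢t = t , ⊢-discharge-∧ʳ (axiom (ax-ind t s A)) ⊢t
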